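{- Let $A,B,C$ be non-collinear points of $\mathrm{PG}(2,q)$ and let $\ell_A=BC$, $\ell_B=CA$, $\ell_C=AB$ be the sides of the triangle, $\mathcal{T}=\ell_A\cup\ell_B\cup\ell_C$. Suppose $H\subseteq\mathcal{T}$ with $|H|=6$ (the holes) and $M$ is a set of $5$ points not on $\mathcal{T}$ (the midpoints) such that $\mathcal{D}=(\mathcal{T}\setminus H)\cup M$ is a double blocking set. Suppose no three holes are collinear. Let $\mathcal{L}$ be the set of lines joining a vertex $I\in\{A,B,C\}$ with a hole lying on $\ell_I$. Then no midpoint is incident with three lines of $\mathcal{L}$.
   Context: A double blocking set of $\mathrm{PG}(2,q)$ is a point set meeting every line in at least two points. -}

module Defs where

open import Level using (Level; _⊔_; suc)
open import Data.Nat using (ℕ)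
open import Data.Fin using (Fin)
open import Data.Product using (Σ; ∃; _×_; _,_)
open import Data.Sum using (_⊎_)
open import Relation.Nullary using (¬_)
open import Algebra.Bundles using (CommutativeRing)

record Field (c ℓ : Level) : Set (suc (c ⊔ ℓ)) where
  field
    commRing  : CommutativeRing c ℓ
  open CommutativeRing commRing public
  field
    1≉0       : ¬ (1# ≈ 0#)
    inverse   : ∀ x → ¬ (x ≈ 0#) → ∃ λ y → (x * y) ≈ 1#

record FiniteField (c ℓ : Level) : Set (suc (c ⊔ ℓ)) where
  field
    fld    : Field c ℓ
  open Field fld public
  field
    q      : ℕ
    enum   : Fin q → Carrier
    enum-onto : ∀ x → ∃ λ i → enum i ≈ x

module PG2 {c ℓ : Level} (F : FiniteField c ℓ) where
  open FiniteField F

  Triple : Set c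
  Triple = Carrier × Carrier × Carrier

  IsZero : Triple → Set ℓ
  IsZero (x , y , z) = (x ≈ 0#) × (y ≈ 0#) × (z ≈ 0#)

  -- points and lines are nonzero coordinate vectors, taken up to scalars
  Point : Set (c ⊔ ℓ)
  Point = Σ Triple λ v → ¬ IsZero v

  Line : Set (c ⊔ ℓ)
  Line = Σ Triple λ v → ¬ IsZero v

  Prop≈ : Triple → Triple → Set (c ⊔ ℓ)
  Prop≈ (x , y , z) (x' , y' , z') =
    ∃ λ t → ((t * x) ≈ x') × ((t * y) ≈ y') × ((t * z) ≈ z')

  SamePoint : Point → Point → Set (c ⊔ ℓ)
  SamePoint (u , _) (v , _) = Prop≈ u v

  SameLine : Line → Line → Set (c ⊔ ℓ)
  SameLine (u , _) (v , _) = Prop≈ u v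

  Inc : Point → Line → Set ℓ
  Inc ((x , y , z) , _) ((a , b , c) , _) = ((a * x + b * y) + c * z) ≈ 0#

  Collinear : Point → Point → Point → Set (c ⊔ ℓ)
  Collinear P Q R = ∃ λ l → Inc P l × Inc Q l × Inc R l

  DoubleBlocking : (Point → Set (c ⊔ ℓ)) → Set (c ⊔ ℓ)
  DoubleBlocking S = ∀ (l : Line) → ∃ λ P → ∃ λ Q →
    ¬ SamePoint P Q × Inc P l × Inc Q l × S P × S Q

  module Triangle (A B C : Point) where
    OnℓA OnℓB OnℓC : Point → Set (c ⊔ ℓ)
    OnℓA P = Collinear B C P
    OnℓB P = Collinear C A P
    OnℓC P = Collinear A B P

    OnT : Point → Set (c ⊔ ℓ)
    OnT P = OnℓA P ⊎ OnℓB P ⊎ OnℓC P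

    InD : (Fin 6 → Point) → (Fin 5 → Point) → Point → Set (c ⊔ ℓ)
    InD H M P = (OnT P × (∀ i → ¬ SamePoint P (H i))) ⊎ (∃ λ j → SamePoint P (M j))

    InL : (Fin 6 → Point) → Line → Set (c ⊔ ℓ)
    InL H l = ∃ λ i →
        (OnℓA (H i) × Inc A l × Inc (H i) l)
      ⊎ (OnℓB (H i) × Inc B l × Inc (H i) l)
      ⊎ (OnℓC (H i) × Inc C l × Inc (H i) l)

-- If M m lies on three lines of 𝓛, these start at different vertices (two lines of
-- 𝓛 through M m and the same vertex coincide), giving at every side s a "spoke" through vertex s,
-- M m and a hole X s lying on side s only. Each side holds at most two holes, so the other three
-- holes lie one on each side, on that side only. For such a hole y on side t, the five lines from y
-- to vertex t, to X t', X t'' and to the two other non-spoke holes meet T \ H at most once, so each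
-- carries a midpoint; the five midpoints differ, hence are all of them, and M m is on one of the
-- lines -- not on the first three, which would be spoke lines. Doing this at two of the three
-- non-spoke holes puts M m on two lines through a common hole, making three holes collinear.
module Submission where

open import Defs
open import Level using (Level; _⊔_)
open import Data.Fin using (Fin; zero; suc)
open import Data.Product using (Σ; ∃; _×_; _,_; proj₁; proj₂)
open import Relation.Binary.PropositionalEquality using (_≢_)
open import Relation.Nullary using (¬_)

open import Algebra using (CommutativeRing)
open import Data.Nat as ℕ using (_≤_; _<_)
import Data.Nat.Properties as ℕ
open import Data.Integer as ℤ using (ℤ; +_; -[1+_]; _⊖_)
import Data.Integer.Properties as ℤ
open import Data.Fin.Properties using (injective⇒≤; ¬∀⟶∃¬) renaming (_≟_ to _≟ᶠ_)
open import Data.List as List using (List; []; _∷_; length; lookup; tabulate)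
open import Data.List.Properties using (length-tabulate; length-map)
open import Data.List.Relation.Unary.All as All using (All; []; _∷_)
import Data.List.Relation.Unary.All.Properties as Allₚ
open import Data.List.Relation.Unary.All.Properties using (¬Any⇒All¬)
open import Data.List.Relation.Unary.AllPairs as AllPairs using (AllPairs; []; _∷_)
import Data.List.Relation.Unary.AllPairs.Properties as AllPairsₚ
open import Data.List.Relation.Unary.AllPairs.Properties using (tabulate⁺)
open import Data.List.Relation.Unary.Any using (here; there; index; any?)
open import Data.List.Relation.Unary.Any.Properties using (lookup-index)
open import Data.List.Relation.Unary.Unique.Propositional using (Unique)
open import Data.List.Membership.Propositional using (_∈_; _∉_)
open import Data.List.Membership.Propositional.Properties using (∈-lookup; ∈-tabulate⁻)
open import Data.Empty using (⊥; ⊥-elim)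
open import Data.Sum using (_⊎_; inj₁; inj₂)
open import Data.Maybe as Maybe using (Maybe)
open import Function using (_∘_; case_of_)
open import Function.Definitions using (Injective)
open import Relation.Binary.Definitions using (Symmetric)
open import Relation.Nullary using (Dec; yes; no)
open import Relation.Nullary.Decidable using (¬¬-excluded-middle; dec⇒maybe)
open import Relation.Binary.PropositionalEquality as ≡ using (_≡_; ≢-sym)


-- A ring solver for any commutative ring R with integer coefficients: the canonical map ℤ → R is
-- a ring homomorphism, so the library solver can normalise polynomials over ℤ (with coefficients
-- in R itself it could not decide that x - x = 0).
module IntegerCoefficients {c ℓ : Level} (R : CommutativeRing c ℓ) where
  open CommutativeRing R
  open import Algebra.Properties.Ring ring using (-‿involutive; -0#≈0#; -‿distribˡ-*; -‿distribʳ-*; -‿+-comm)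
  open import Algebra.Properties.Monoid.Mult +-monoid using (×-homo-+) renaming (_×_ to _·_)
  open import Algebra.Properties.Semiring.Mult semiring using (×1-homo-*)
  open import Algebra.Solver.Ring.AlmostCommutativeRing using (fromCommutativeRing; _-Raw-AlmostCommutative⟶_)
  open import Relation.Binary.Reasoning.Setoid setoid

  ⟦_⟧ℤ : ℤ → Carrier
  ⟦ + n ⟧ℤ = n · 1#
  ⟦ -[1+ n ] ⟧ℤ = - (ℕ.suc n · 1#)

  -‿homo : ∀ i → ⟦ ℤ.- i ⟧ℤ ≈ - ⟦ i ⟧ℤ
  -‿homo (+ ℕ.zero) = sym -0#≈0#
  -‿homo (+ ℕ.suc n) = refl
  -‿homo -[1+ n ] = sym (-‿involutive _)

  difference-shift : ∀ x a b → a + - b ≈ (x + a) + - (x + b)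
  difference-shift x a b = begin
    a + - b               ≈⟨ +-identityˡ _ ⟨
    0# + (a + - b)        ≈⟨ +-congʳ (-‿inverseʳ x) ⟨
    (x + - x) + (a + - b) ≈⟨ +-assoc x (- x) _ ⟩
    x + (- x + (a + - b)) ≈⟨ +-congˡ (+-assoc (- x) a (- b)) ⟨
    x + ((- x + a) + - b) ≈⟨ +-congˡ (+-congʳ (+-comm (- x) a)) ⟩
    x + ((a + - x) + - b) ≈⟨ +-congˡ (+-assoc a (- x) (- b)) ⟩
    x + (a + (- x + - b)) ≈⟨ +-assoc x a _ ⟨
    (x + a) + (- x + - b) ≈⟨ +-congˡ (-‿+-comm x b) ⟩
    (x + a) + - (x + b)   ∎

  ⊖-homo : ∀ m n → ⟦ m ⊖ n ⟧ℤ ≈ m · 1# + - (n · 1#)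
  ⊖-homo ℕ.zero    ℕ.zero    = sym (-‿inverseʳ 0#)
  ⊖-homo (ℕ.suc m) ℕ.zero    = sym (trans (+-congˡ -0#≈0#) (+-identityʳ _))
  ⊖-homo ℕ.zero    (ℕ.suc n) = sym (+-identityˡ _)
  ⊖-homo (ℕ.suc m) (ℕ.suc n) = begin
    ⟦ ℕ.suc m ⊖ ℕ.suc n ⟧ℤ           ≡⟨ ≡.cong ⟦_⟧ℤ (ℤ.[1+m]⊖[1+n]≡m⊖n m n) ⟩
    ⟦ m ⊖ n ⟧ℤ                       ≈⟨ ⊖-homo m n ⟩
    m · 1# + - (n · 1#)              ≈⟨ difference-shift 1# _ _ ⟩
    ℕ.suc m · 1# + - (ℕ.suc n · 1#)  ∎

  +-homo : ∀ i j → ⟦ i ℤ.+ j ⟧ℤ ≈ ⟦ i ⟧ℤ + ⟦ j ⟧ℤ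
  +-homo (+ m)    (+ n)    = ×-homo-+ 1# m n
  +-homo (+ m)    -[1+ n ] = ⊖-homo m (ℕ.suc n)
  +-homo -[1+ m ] (+ n)    = trans (⊖-homo n (ℕ.suc m)) (+-comm _ _)
  +-homo -[1+ m ] -[1+ n ] = begin
    - (ℕ.suc (ℕ.suc (m ℕ.+ n)) · 1#)      ≡⟨ ≡.cong (λ k → - (k · 1#)) (ℕ.+-suc (ℕ.suc m) n) ⟨
    - ((ℕ.suc m ℕ.+ ℕ.suc n) · 1#)        ≈⟨ -‿cong (×-homo-+ 1# (ℕ.suc m) (ℕ.suc n)) ⟩
    - (ℕ.suc m · 1# + ℕ.suc n · 1#)       ≈⟨ -‿+-comm _ _ ⟨
    - (ℕ.suc m · 1#) + - (ℕ.suc n · 1#)   ∎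

  *-homo : ∀ i j → ⟦ i ℤ.* j ⟧ℤ ≈ ⟦ i ⟧ℤ * ⟦ j ⟧ℤ
  *-homo (+ m) (+ n) = begin
    ⟦ + m ℤ.* + n ⟧ℤ     ≡⟨ ≡.cong ⟦_⟧ℤ (ℤ.pos-* m n) ⟨
    (m ℕ.* n) · 1#       ≈⟨ ×1-homo-* m n ⟩
    (m · 1#) * (n · 1#)  ∎
  *-homo (+ m) -[1+ n ] = begin
    ⟦ + m ℤ.* ℤ.- + ℕ.suc n ⟧ℤ      ≡⟨ ≡.cong ⟦_⟧ℤ (ℤ.neg-distribʳ-* (+ m) (+ ℕ.suc n)) ⟨
    ⟦ ℤ.- (+ m ℤ.* + ℕ.suc n) ⟧ℤ    ≈⟨ -‿homo (+ m ℤ.* + ℕ.suc n) ⟩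
    - ⟦ + m ℤ.* + ℕ.suc n ⟧ℤ        ≈⟨ -‿cong (*-homo (+ m) (+ ℕ.suc n)) ⟩
    - ((m · 1#) * (ℕ.suc n · 1#))   ≈⟨ -‿distribʳ-* _ _ ⟩
    (m · 1#) * - (ℕ.suc n · 1#)     ∎
  *-homo -[1+ m ] (+ n) = begin
    ⟦ ℤ.- + ℕ.suc m ℤ.* + n ⟧ℤ      ≡⟨ ≡.cong ⟦_⟧ℤ (ℤ.neg-distribˡ-* (+ ℕ.suc m) (+ n)) ⟨
    ⟦ ℤ.- (+ ℕ.suc m ℤ.* + n) ⟧ℤ    ≈⟨ -‿homo (+ ℕ.suc m ℤ.* + n) ⟩
    - ⟦ + ℕ.suc m ℤ.* + n ⟧ℤ        ≈⟨ -‿cong (*-homo (+ ℕ.suc m) (+ n)) ⟩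
    - ((ℕ.suc m · 1#) * (n · 1#))   ≈⟨ -‿distribˡ-* _ _ ⟩
    - (ℕ.suc m · 1#) * (n · 1#)     ∎
  *-homo -[1+ m ] -[1+ n ] = begin
    (ℕ.suc m ℕ.* ℕ.suc n) · 1#  ≈⟨ ×1-homo-* (ℕ.suc m) (ℕ.suc n) ⟩
    a * b                       ≈⟨ -‿involutive _ ⟨
    - - (a * b)                 ≈⟨ -‿cong (-‿distribʳ-* a b) ⟩
    - (a * - b)                 ≈⟨ -‿distribˡ-* a (- b) ⟩
    - a * - b                   ∎
    where a = ℕ.suc m · 1#
          b = ℕ.suc n · 1#

  ℤ-morphism : ℤ.+-*-rawRing -Raw-AlmostCommutative⟶ fromCommutativeRing R
  ℤ-morphism = record
    { ⟦_⟧ = ⟦_⟧ℤ ; +-homo = +-homo ; *-homo = *-homo ; -‿homo = -‿homo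
    ; 0-homo = refl ; 1-homo = +-identityʳ 1# }

  coefficients? : ∀ i j → Maybe (⟦ i ⟧ℤ ≈ ⟦ j ⟧ℤ)
  coefficients? i j = Maybe.map (reflexive ∘ ≡.cong ⟦_⟧ℤ) (dec⇒maybe (i ℤ.≟ j))

  open import Algebra.Solver.Ring ℤ.+-*-rawRing (fromCommutativeRing R) ℤ-morphism coefficients? public

allPairs-lookup : ∀ {a r} {A : Set a} {R : A → A → Set r} {xs : List A} → Symmetric R →
  AllPairs R xs → ∀ {i j} → i ≢ j → R (lookup xs i) (lookup xs j)
allPairs-lookup sym (_ ∷ _)   {zero}  {zero}  i≢j = ⊥-elim (i≢j ≡.refl)
allPairs-lookup sym (Rx ∷ _)  {zero}  {suc j} _   = All.lookup Rx (∈-lookup j)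
allPairs-lookup sym (Rx ∷ _)  {suc i} {zero}  _   = sym (All.lookup Rx (∈-lookup i))
allPairs-lookup sym (_ ∷ Rxs) {suc i} {suc j} i≢j = allPairs-lookup sym Rxs (i≢j ∘ ≡.cong suc)

unique⇒length≤ : ∀ {n} {xs : List (Fin n)} → Unique xs → length xs ≤ n
unique⇒length≤ {xs = xs} unique = injective⇒≤ lookup-injective
  where
  lookup-injective : Injective _≡_ _≡_ (lookup xs)
  lookup-injective {i} {j} xᵢ≡xⱼ with i ≟ᶠ j
  ... | yes i≡j = i≡j
  ... | no i≢j = ⊥-elim (allPairs-lookup ≢-sym unique i≢j xᵢ≡xⱼ)

unique-enumerates : ∀ {n} {xs : List (Fin n)} → Unique xs → length xs ≡ n → ∀ m → m ∈ xs
unique-enumerates {xs = xs} unique |xs|≡n m with any? (m ≟ᶠ_) xs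
... | yes m∈xs = m∈xs
... | no m∉xs = ⊥-elim (ℕ.<-irrefl |xs|≡n (unique⇒length≤ (¬Any⇒All¬ xs m∉xs ∷ unique)))

fresh : ∀ {n} (xs : List (Fin n)) → length xs < n → ∃ λ y → y ∉ xs
fresh {n} xs |xs|<n = ¬∀⟶∃¬ n (_∈ xs) (λ i → any? (i ≟ᶠ_) xs) λ all∈ →
  ℕ.<⇒≱ |xs|<n (injective⇒≤ {f = λ i → index (all∈ i)} λ {i} {j} indexᵢ≡indexⱼ →
    ≡.trans (lookup-index (all∈ i)) (≡.trans (≡.cong (lookup xs) indexᵢ≡indexⱼ) (≡.sym (lookup-index (all∈ j)))))

¬¬-Fin-choice : ∀ {n p} {P : Fin n → Set p} → (∀ i → ¬ ¬ P i) → ¬ ¬ (∀ i → P i)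
¬¬-Fin-choice {ℕ.zero} _ ¬all = ¬all λ ()
¬¬-Fin-choice {ℕ.suc n} ¬¬P ¬all = ¬¬P zero λ P₀ → ¬¬-Fin-choice (¬¬P ∘ suc) λ Pₛ → ¬all λ where
  zero → P₀
  (suc i) → Pₛ i

-- Coordinates of PG(2,F).
module Plane {c ℓ : Level} (F : FiniteField c ℓ) where
  open FiniteField F
  open PG2 F
  open IntegerCoefficients commRing using (solve; _:=_; _:+_; _:-_; _:*_; con)
  open import Algebra.Properties.Group +-group using (x∙y⁻¹≈ε⇒x≈y)
  open import Relation.Binary.Reasoning.Setoid setoid

  -- Inc P l unfolds to dot l P
  dot : Triple → Triple → Carrier
  dot (a , b , c) (x , y , z) = (a * x + b * y) + c * z

  -- the cross product: orthogonal to both factors, so it joins two points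
  cross : Triple → Triple → Triple
  cross (x , y , z) (a , b , c) = (y * c + - (z * b) , z * a + - (x * c) , x * b + - (y * a))

  cross-orthogonalˡ : ∀ u v → dot (cross u v) u ≈ 0#
  cross-orthogonalˡ (x , y , z) (a , b , c) = solve 6 (λ x y z a b c →
    (y :* c :- z :* b) :* x :+ (z :* a :- x :* c) :* y :+ (x :* b :- y :* a) :* z
    := con (+ 0)) refl x y z a b c

  cross-orthogonalʳ : ∀ u v → dot (cross u v) v ≈ 0#
  cross-orthogonalʳ (x , y , z) (a , b , c) = solve 6 (λ x y z a b c →
    (y :* c :- z :* b) :* a :+ (z :* a :- x :* c) :* b :+ (x :* b :- y :* a) :* c
    := con (+ 0)) refl x y z a b c

  vanish : ∀ {e} A B {x y} → e ≈ A * x + - (B * y) → x ≈ 0# → y ≈ 0# → e ≈ 0#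
  vanish {e} A B {x} {y} e≈ x≈0 y≈0 = begin
    e                   ≈⟨ e≈ ⟩
    A * x + - (B * y)   ≈⟨ +-cong (*-congˡ x≈0) (-‿cong (*-congˡ y≈0)) ⟩
    A * 0# + - (B * 0#) ≈⟨ +-cong (zeroʳ A) (-‿cong (zeroʳ B)) ⟩
    0# + - 0#           ≈⟨ -‿inverseʳ 0# ⟩
    0#                  ∎

  -- by the expansion (p × q) × l = (l·p) q − (l·q) p, the cross product of
  -- p × q with any line through p and q vanishes
  join-cross-line : ∀ p q l → dot l p ≈ 0# → dot l q ≈ 0# → IsZero (cross (cross p q) l)
  join-cross-line (p₁ , p₂ , p₃) (q₁ , q₂ , q₃) (l₁ , l₂ , l₃) l∙p≈0 l∙q≈0 =
      vanish q₁ p₁ (solve 9 (λ l₁ l₂ l₃ p₁ p₂ p₃ q₁ q₂ q₃ →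
        (p₃ :* q₁ :- p₁ :* q₃) :* l₃ :- (p₁ :* q₂ :- p₂ :* q₁) :* l₂
        := q₁ :* (l₁ :* p₁ :+ l₂ :* p₂ :+ l₃ :* p₃) :- p₁ :* (l₁ :* q₁ :+ l₂ :* q₂ :+ l₃ :* q₃))
        refl l₁ l₂ l₃ p₁ p₂ p₃ q₁ q₂ q₃) l∙p≈0 l∙q≈0
    , vanish q₂ p₂ (solve 9 (λ l₁ l₂ l₃ p₁ p₂ p₃ q₁ q₂ q₃ →
        (p₁ :* q₂ :- p₂ :* q₁) :* l₁ :- (p₂ :* q₃ :- p₃ :* q₂) :* l₃
        := q₂ :* (l₁ :* p₁ :+ l₂ :* p₂ :+ l₃ :* p₃) :- p₂ :* (l₁ :* q₁ :+ l₂ :* q₂ :+ l₃ :* q₃))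
        refl l₁ l₂ l₃ p₁ p₂ p₃ q₁ q₂ q₃) l∙p≈0 l∙q≈0
    , vanish q₃ p₃ (solve 9 (λ l₁ l₂ l₃ p₁ p₂ p₃ q₁ q₂ q₃ →
        (p₂ :* q₃ :- p₃ :* q₂) :* l₂ :- (p₃ :* q₁ :- p₁ :* q₃) :* l₁
        := q₃ :* (l₁ :* p₁ :+ l₂ :* p₂ :+ l₃ :* p₃) :- p₃ :* (l₁ :* q₁ :+ l₂ :* q₂ :+ l₃ :* q₃))
        refl l₁ l₂ l₃ p₁ p₂ p₃ q₁ q₂ q₃) l∙p≈0 l∙q≈0

  inc-resp-point : ∀ (P Q : Point) (l : Line) → SamePoint P Q → Inc P l → Inc Q l
  inc-resp-point ((x , y , z) , _) ((x' , y' , z') , _) ((a , b , c) , _) (t , tx≈x' , ty≈y' , tz≈z') P∈l = begin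
    (a * x' + b * y') + c * z'                ≈⟨ +-cong (+-cong (*-congˡ tx≈x') (*-congˡ ty≈y')) (*-congˡ tz≈z') ⟨
    (a * (t * x) + b * (t * y)) + c * (t * z) ≈⟨ solve 7 (λ a b c t x y z →
      a :* (t :* x) :+ b :* (t :* y) :+ c :* (t :* z) := t :* (a :* x :+ b :* y :+ c :* z)) refl a b c t x y z ⟩
    t * ((a * x + b * y) + c * z)             ≈⟨ *-congˡ P∈l ⟩
    t * 0#                                    ≈⟨ zeroʳ t ⟩
    0#                                        ∎

  inc-resp-line : ∀ (P : Point) (l l' : Line) → SameLine l l' → Inc P l → Inc P l'
  inc-resp-line ((x , y , z) , _) ((a , b , c) , _) ((a' , b' , c') , _) (t , ta≈a' , tb≈b' , tc≈c') P∈l = begin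
    (a' * x + b' * y) + c' * z                ≈⟨ +-cong (+-cong (*-congʳ ta≈a') (*-congʳ tb≈b')) (*-congʳ tc≈c') ⟨
    ((t * a) * x + (t * b) * y) + (t * c) * z ≈⟨ solve 7 (λ a b c t x y z →
      (t :* a) :* x :+ (t :* b) :* y :+ (t :* c) :* z := t :* (a :* x :+ b :* y :+ c :* z)) refl a b c t x y z ⟩
    t * ((a * x + b * y) + c * z)             ≈⟨ *-congˡ P∈l ⟩
    t * 0#                                    ≈⟨ zeroʳ t ⟩
    0#                                        ∎

  divide : ∀ {a w d e f} → a * w ≈ 1# → e * d ≈ a * f → (d * w) * e ≈ f
  divide {a} {w} {d} {e} {f} aw≈1 ed≈af = begin
    (d * w) * e  ≈⟨ solve 3 (λ d w e → (d :* w) :* e := w :* (e :* d)) refl d w e ⟩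
    w * (e * d)  ≈⟨ *-congˡ ed≈af ⟩
    w * (a * f)  ≈⟨ solve 3 (λ w a f → w :* (a :* f) := (a :* w) :* f) refl w a f ⟩
    (a * w) * f  ≈⟨ *-congʳ aw≈1 ⟩
    1# * f       ≈⟨ *-identityˡ f ⟩
    f            ∎

  cross-zero⇒proportional : ∀ u v → ¬ IsZero u → IsZero (cross u v) → ¬ ¬ Prop≈ u v
  cross-zero⇒proportional (a , b , c) (a' , b' , c') u≉0 (z₁ , z₂ , z₃) ¬u∼v =
    a≈0 λ a≈0 → b≈0 λ b≈0 → c≈0 λ c≈0 → u≉0 (a≈0 , b≈0 , c≈0)
    where
    -- a coordinate x ≉ 0 gives the explicit factor x'/x
    a≈0 : ¬ ¬ (a ≈ 0#)
    a≈0 a≉0 with w , aw≈1 ← inverse a a≉0 =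
      ¬u∼v (a' * w , divide aw≈1 refl , divide aw≈1 (sym (x∙y⁻¹≈ε⇒x≈y _ _ z₃)) , divide aw≈1 (x∙y⁻¹≈ε⇒x≈y _ _ z₂))
    b≈0 : ¬ ¬ (b ≈ 0#)
    b≈0 b≉0 with w , bw≈1 ← inverse b b≉0 =
      ¬u∼v (b' * w , divide bw≈1 (x∙y⁻¹≈ε⇒x≈y _ _ z₃) , divide bw≈1 refl , divide bw≈1 (sym (x∙y⁻¹≈ε⇒x≈y _ _ z₁)))
    c≈0 : ¬ ¬ (c ≈ 0#)
    c≈0 c≉0 with w , cw≈1 ← inverse c c≉0 =
      ¬u∼v (c' * w , divide cw≈1 (sym (x∙y⁻¹≈ε⇒x≈y _ _ z₂)) , divide cw≈1 (x∙y⁻¹≈ε⇒x≈y _ _ z₁) , divide cw≈1 refl)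

  prop-sym : ∀ u v → ¬ IsZero v → Prop≈ u v → Prop≈ v u
  prop-sym (x , y , z) (x' , y' , z') v≉0 (t , tx≈x' , ty≈y' , tz≈z') =
    w , unscale tx≈x' , unscale ty≈y' , unscale tz≈z'
    where
    vanishes : ∀ {p q} → t ≈ 0# → t * p ≈ q → q ≈ 0#
    vanishes {p} t≈0 tp≈q = trans (sym tp≈q) (trans (*-congʳ t≈0) (zeroˡ p))

    t≉0 : ¬ t ≈ 0#
    t≉0 t≈0 = v≉0 (vanishes t≈0 tx≈x' , vanishes t≈0 ty≈y' , vanishes t≈0 tz≈z')

    w : Carrier
    w = proj₁ (inverse t t≉0)

    unscale : ∀ {p q} → t * p ≈ q → w * q ≈ p
    unscale {p} {q} tp≈q = begin
      w * q        ≈⟨ *-congˡ tp≈q ⟨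
      w * (t * p)  ≈⟨ solve 3 (λ w t p → w :* (t :* p) := (t :* w) :* p) refl w t p ⟩
      (t * w) * p  ≈⟨ *-congʳ (proj₂ (inverse t t≉0)) ⟩
      1# * p       ≈⟨ *-identityˡ p ⟩
      p            ∎

  prop-trans : ∀ u v x → Prop≈ u v → Prop≈ v x → Prop≈ u x
  prop-trans _ _ _ (t , t₁ , t₂ , t₃) (s , s₁ , s₂ , s₃) = s * t , compose t₁ s₁ , compose t₂ s₂ , compose t₃ s₃
    where
    compose : ∀ {p q r} → t * p ≈ q → s * q ≈ r → (s * t) * p ≈ r
    compose {p} tp≈q sq≈r = trans (*-assoc s t p) (trans (*-congˡ tp≈q) sq≈r)

  same-point-sym : ∀ (P Q : Point) → SamePoint P Q → SamePoint Q P
  same-point-sym (u , _) (v , v≉0) = prop-sym u v v≉0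

  same-point-trans : ∀ (P Q R : Point) → SamePoint P Q → SamePoint Q R → SamePoint P R
  same-point-trans (u , _) (v , _) (x , _) = prop-trans u v x

  same-line-sym : ∀ (l l' : Line) → SameLine l l' → SameLine l' l
  same-line-sym (u , _) (v , v≉0) = prop-sym u v v≉0

  join : (P Q : Point) → ¬ SamePoint P Q → Line
  join (p , p≉0) (q , _) P≁Q = cross p q , λ p×q≈0 → cross-zero⇒proportional p q p≉0 p×q≈0 P≁Q

  join-incˡ : ∀ P Q P≁Q → Inc P (join P Q P≁Q)
  join-incˡ (p , _) (q , _) _ = cross-orthogonalˡ p q

  join-incʳ : ∀ P Q P≁Q → Inc Q (join P Q P≁Q)
  join-incʳ (p , _) (q , _) _ = cross-orthogonalʳ p q

  line-unique : ∀ (P Q : Point) (l l' : Line) → ¬ SamePoint P Q →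
    Inc P l → Inc Q l → Inc P l' → Inc Q l' → ¬ ¬ SameLine l l'
  line-unique P@(p , _) Q@(q , _) (u , u≉0) (v , _) P≁Q P∈l Q∈l P∈l' Q∈l' l≁l' =
    cross-zero⇒proportional w u w≉0 (join-cross-line p q u P∈l Q∈l) λ w∼u →
    cross-zero⇒proportional w v w≉0 (join-cross-line p q v P∈l' Q∈l') λ w∼v →
    l≁l' (prop-trans u w v (prop-sym w u u≉0 w∼u) w∼v)
    where
    w = cross p q
    w≉0 = proj₂ (join P Q P≁Q)

  inc-transfer : ∀ (P Q R : Point) (l l' : Line) → ¬ SamePoint P Q →
    Inc P l → Inc Q l → Inc P l' → Inc Q l' → Inc R l' → ¬ ¬ Inc R l
  inc-transfer P Q R l l' P≁Q P∈l Q∈l P∈l' Q∈l' R∈l' R∉l =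
    line-unique P Q l' l P≁Q P∈l' Q∈l' P∈l Q∈l λ l'∼l → R∉l (inc-resp-line R l' l l'∼l R∈l')

  meet-unique : ∀ (R X Y : Point) (l l' : Line) → Inc R l → ¬ Inc R l' →
    Inc X l → Inc X l' → Inc Y l → Inc Y l' → ¬ ¬ SamePoint X Y
  meet-unique R X Y l l' R∈l R∉l' X∈l X∈l' Y∈l Y∈l' X≁Y =
    inc-transfer X Y R l' l X≁Y X∈l' Y∈l' X∈l Y∈l R∈l R∉l'

  -- two distinct coordinate points, so every point differs from one of them
  e₁ e₂ : Point
  e₁ = (1# , 0# , 0#) , λ (1≈0 , _ , _) → 1≉0 1≈0
  e₂ = (0# , 1# , 0#) , λ (_ , 1≈0 , _) → 1≉0 1≈0

  e₁≁e₂ : ¬ SamePoint e₁ e₂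
  e₁≁e₂ (t , _ , t0≈1 , _) = 1≉0 (trans (sym t0≈1) (zeroʳ t))

  line-through : ∀ (P : Point) → ¬ ¬ (Σ Line λ l → Inc P l)
  line-through P ¬line = ¬¬-excluded-middle λ where
    (no P≁e₁) → ¬line (join P e₁ P≁e₁ , join-incˡ P e₁ P≁e₁)
    (yes P∼e₁) → ¬¬-excluded-middle λ where
      (no P≁e₂) → ¬line (join P e₂ P≁e₂ , join-incˡ P e₂ P≁e₂)
      (yes P∼e₂) → e₁≁e₂ (same-point-trans e₁ P e₂ (same-point-sym P e₁ P∼e₁) P∼e₂)

  joinable : ∀ (P Q : Point) → ¬ ¬ (Σ Line λ l → Inc P l × Inc Q l)
  joinable P Q ¬line = ¬¬-excluded-middle λ where
    (no P≁Q) → ¬line (join P Q P≁Q , join-incˡ P Q P≁Q , join-incʳ P Q P≁Q)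
    (yes P∼Q) → line-through P λ (l , P∈l) → ¬line (l , P∈l , inc-resp-point P Q l P∼Q P∈l)

  collinear⇒on-join : ∀ {X Y P} (X≁Y : ¬ SamePoint X Y) → Collinear X Y P → ¬ ¬ Inc P (join X Y X≁Y)
  collinear⇒on-join {X} {Y} {P} X≁Y (l , X∈l , Y∈l , P∈l) =
    inc-transfer X Y P (join X Y X≁Y) l X≁Y (join-incˡ X Y X≁Y) (join-incʳ X Y X≁Y) X∈l Y∈l P∈l

  noncollinear⇒different-lines : ∀ {Y P Q} (l l' : Line) → Inc Y l → Inc P l → Inc Y l' → Inc Q l' →
    ¬ Collinear Y P Q → ¬ SameLine l l'
  noncollinear⇒different-lines {P = P} l l' _ P∈l Y∈l' Q∈l' YPQ-noncollinear l∼l' =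
    YPQ-noncollinear (l' , Y∈l' , inc-resp-line P l l' l∼l' P∈l , Q∈l')

-- the three sides of a triangle, each named after the opposite vertex
Side : Set
Side = Fin 3

pattern sideA = zero
pattern sideB = suc zero
pattern sideC = suc (suc zero)

all-sides : ∀ {s₁ s₂ s₃ : Side} → s₁ ≢ s₂ → s₁ ≢ s₃ → s₂ ≢ s₃ → ∀ s → s ∈ s₁ ∷ s₂ ∷ s₃ ∷ []
all-sides s₁≢s₂ s₁≢s₃ s₂≢s₃ = unique-enumerates ((s₁≢s₂ ∷ s₁≢s₃ ∷ []) ∷ (s₂≢s₃ ∷ []) ∷ [] ∷ []) ≡.refl

third-side-unique : ∀ {t t' s s' : Side} → t ≢ t' → s ≢ t → s ≢ t' → s' ≢ t → s' ≢ t' → s ≡ s'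
third-side-unique t≢t' s≢t s≢t' s'≢t s'≢t' with all-sides t≢t' (≢-sym s≢t) (≢-sym s≢t') _
... | here s'≡t = ⊥-elim (s'≢t s'≡t)
... | there (here s'≡t') = ⊥-elim (s'≢t' s'≡t')
... | there (there (here s'≡s)) = ≡.sym s'≡s

other-side : ∀ (t s : Side) → ∃ λ u → u ≢ t × u ≢ s
other-side t s with u , u∉ts ← fresh (t ∷ s ∷ []) (ℕ.<ᵇ⇒< 2 3 _) = u , u∉ts ∘ here , u∉ts ∘ there ∘ here

module TriangleGeometry {c ℓ : Level} (F : FiniteField c ℓ) (A B C : PG2.Point F)
                        (ABC-noncollinear : ¬ PG2.Collinear F A B C) where
  open PG2 F
  open Triangle A B C
  open Plane F

  B≁C : ¬ SamePoint B C
  B≁C B∼C = joinable A B λ (l , A∈l , B∈l) → ABC-noncollinear (l , A∈l , B∈l , inc-resp-point B C l B∼C B∈l)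

  C≁A : ¬ SamePoint C A
  C≁A C∼A = joinable A B λ (l , A∈l , B∈l) →
    ABC-noncollinear (l , A∈l , B∈l , inc-resp-point A C l (same-point-sym C A C∼A) A∈l)

  A≁B : ¬ SamePoint A B
  A≁B A∼B = joinable A C λ (l , A∈l , C∈l) → ABC-noncollinear (l , A∈l , inc-resp-point A B l A∼B A∈l , C∈l)

  vertex : Side → Point
  vertex sideA = A
  vertex sideB = B
  vertex sideC = C

  side : Side → Line
  side sideA = join B C B≁C
  side sideB = join C A C≁A
  side sideC = join A B A≁B

  vertex-on-side : ∀ {s t} → s ≢ t → Inc (vertex s) (side t)
  vertex-on-side {sideA} {sideA} s≢t = ⊥-elim (s≢t ≡.refl)
  vertex-on-side {sideA} {sideB} _   = join-incʳ C A C≁A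
  vertex-on-side {sideA} {sideC} _   = join-incˡ A B A≁B
  vertex-on-side {sideB} {sideA} _   = join-incˡ B C B≁C
  vertex-on-side {sideB} {sideB} s≢t = ⊥-elim (s≢t ≡.refl)
  vertex-on-side {sideB} {sideC} _   = join-incʳ A B A≁B
  vertex-on-side {sideC} {sideA} _   = join-incʳ B C B≁C
  vertex-on-side {sideC} {sideB} _   = join-incˡ C A C≁A
  vertex-on-side {sideC} {sideC} s≢t = ⊥-elim (s≢t ≡.refl)

  vertex-off-side : ∀ s → ¬ Inc (vertex s) (side s)
  vertex-off-side sideA A∈ℓA = ABC-noncollinear (side sideA , A∈ℓA , join-incˡ B C B≁C , join-incʳ B C B≁C)
  vertex-off-side sideB B∈ℓB = ABC-noncollinear (side sideB , join-incʳ C A C≁A , B∈ℓB , join-incˡ C A C≁A)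
  vertex-off-side sideC C∈ℓC = ABC-noncollinear (side sideC , join-incˡ A B A≁B , join-incʳ A B A≁B , C∈ℓC)

  on-side⇒OnT : ∀ s {P} → Inc P (side s) → OnT P
  on-side⇒OnT sideA P∈ℓA = inj₁ (side sideA , join-incˡ B C B≁C , join-incʳ B C B≁C , P∈ℓA)
  on-side⇒OnT sideB P∈ℓB = inj₂ (inj₁ (side sideB , join-incˡ C A C≁A , join-incʳ C A C≁A , P∈ℓB))
  on-side⇒OnT sideC P∈ℓC = inj₂ (inj₂ (side sideC , join-incˡ A B A≁B , join-incʳ A B A≁B , P∈ℓC))

  OnT⇒on-side : ∀ {P} → OnT P → ¬ ¬ (∃ λ s → Inc P (side s))
  OnT⇒on-side {P} (inj₁ P∈BC)        ¬on = collinear⇒on-join {B} {C} {P} B≁C P∈BC λ P∈ℓA → ¬on (sideA , P∈ℓA)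
  OnT⇒on-side {P} (inj₂ (inj₁ P∈CA)) ¬on = collinear⇒on-join {C} {A} {P} C≁A P∈CA λ P∈ℓB → ¬on (sideB , P∈ℓB)
  OnT⇒on-side {P} (inj₂ (inj₂ P∈AB)) ¬on = collinear⇒on-join {A} {B} {P} A≁B P∈AB λ P∈ℓC → ¬on (sideC , P∈ℓC)

  OnlyOn : Side → Point → Set ℓ
  OnlyOn s P = Inc P (side s) × (∀ t → t ≢ s → ¬ Inc P (side t))

  -- a vertex lies on two sides, so it is not a point lying on one side only
  only-on⇒not-vertex : ∀ {s} P t → OnlyOn s P → ¬ SamePoint (vertex t) P
  only-on⇒not-vertex {s} P t (_ , off-other-sides) Vₜ∼P with u , u≢t , u≢s ← other-side t s =
    off-other-sides u u≢s (inc-resp-point (vertex t) P (side u) Vₜ∼P (vertex-on-side (≢-sym u≢t)))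

  module Configuration (H : Fin 6 → Point) (M : Fin 5 → Point)
    (holes-distinct : ∀ i j → i ≢ j → ¬ SamePoint (H i) (H j))
    (holes-on-T : ∀ i → OnT (H i))
    (midpoints-off-T : ∀ j → ¬ OnT (M j))
    (double-blocking : DoubleBlocking (InD H M))
    (no-three-holes-collinear : ∀ i j k → i ≢ j → j ≢ k → i ≢ k → ¬ Collinear (H i) (H j) (H k)) where

    midpoint-off-side : ∀ j s → ¬ Inc (M j) (side s)
    midpoint-off-side j s Mⱼ∈s = midpoints-off-T j (on-side⇒OnT s {M j} Mⱼ∈s)

    midpoint-not-on-side : ∀ j s P → Inc P (side s) → ¬ SamePoint (M j) P
    midpoint-not-on-side j s P P∈s Mⱼ∼P =
      midpoint-off-side j s (inc-resp-point P (M j) (side s) (same-point-sym (M j) P Mⱼ∼P) P∈s)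

    midpoint-not-vertex : ∀ j s → ¬ SamePoint (M j) (vertex s)
    midpoint-not-vertex j s with u , u≢s , _ ← other-side s s = midpoint-not-on-side j u (vertex s) (vertex-on-side (≢-sym u≢s))

    Survivor : Point → Set (c ⊔ ℓ)
    Survivor P = OnT P × (∀ i → ¬ SamePoint P (H i))

    Sparse : Line → Set (c ⊔ ℓ)
    Sparse l = ∀ X Y → ¬ SamePoint X Y → Inc X l → Inc Y l → Survivor X → Survivor Y → ⊥

    -- D meets every line twice, so a sparse line contains a midpoint
    sparse⇒midpoint : ∀ l → Sparse l → ¬ ¬ (∃ λ j → Inc (M j) l)
    sparse⇒midpoint l sparse ¬midpoint with double-blocking l
    ... | X , Y , X≁Y , X∈l , Y∈l , inj₂ (j , X∼Mⱼ) , _ = ¬midpoint (j , inc-resp-point X (M j) l X∼Mⱼ X∈l)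
    ... | X , Y , X≁Y , X∈l , Y∈l , inj₁ _ , inj₂ (j , Y∼Mⱼ) = ¬midpoint (j , inc-resp-point Y (M j) l Y∼Mⱼ Y∈l)
    ... | X , Y , X≁Y , X∈l , Y∈l , inj₁ X∈T∖H , inj₁ Y∈T∖H = sparse X Y X≁Y X∈l Y∈l X∈T∖H Y∈T∖H

    -- A pencil of five lines joining a point Y, other than the midpoints, to five points such
    -- that each line is sparse and no two of the points are collinear with Y: each line carries
    -- a midpoint and no midpoint lies on two of them, so, as there are only five midpoints,
    -- every midpoint lies on one of the lines.
    module Pencil (Y : Point) (targets : List Point) (five-targets : length targets ≡ 5)
      (M≁Y : ∀ j → ¬ SamePoint (M j) Y)
      (Y≁targets : All (λ P → ¬ SamePoint Y P) targets)
      (sparse-joins : All (λ P → ∀ l → Inc Y l → Inc P l → Sparse l) targets)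
      (noncollinear : AllPairs (λ P Q → ¬ Collinear Y P Q) targets) where

      target : Fin (length targets) → Point
      target = lookup targets

      Y≁target : ∀ i → ¬ SamePoint Y (target i)
      Y≁target i = All.lookup Y≁targets (∈-lookup i)

      ray : Fin (length targets) → Line
      ray i = join Y (target i) (Y≁target i)

      Y∈ray : ∀ i → Inc Y (ray i)
      Y∈ray i = join-incˡ Y (target i) (Y≁target i)

      target∈ray : ∀ i → Inc (target i) (ray i)
      target∈ray i = join-incʳ Y (target i) (Y≁target i)

      rays-different : ∀ {i j} → i ≢ j → ¬ SameLine (ray i) (ray j)
      rays-different {i} {j} i≢j =
        noncollinear⇒different-lines {Y} {target i} {target j} (ray i) (ray j)
          (Y∈ray i) (target∈ray i) (Y∈ray j) (target∈ray j)
          (allPairs-lookup {R = λ P Q → ¬ Collinear Y P Q} (λ {P} {Q} → swap {P} {Q}) noncollinear i≢j)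
        where
        swap : Symmetric (λ P Q → ¬ Collinear Y P Q)
        swap ¬YPQ (l , Y∈l , Q∈l , P∈l) = ¬YPQ (l , Y∈l , P∈l , Q∈l)

      chosen-distinct : (chosen : ∀ i → ∃ λ j → Inc (M j) (ray i)) →
        ∀ {i j} → i ≢ j → proj₁ (chosen i) ≢ proj₁ (chosen j)
      chosen-distinct chosen {i} {j} i≢j μᵢ≡μⱼ =
        line-unique (M (proj₁ (chosen i))) Y (ray i) (ray j) (M≁Y _) (proj₂ (chosen i)) (Y∈ray i)
          (≡.subst (λ k → Inc (M k) (ray j)) (≡.sym μᵢ≡μⱼ) (proj₂ (chosen j))) (Y∈ray j) (rays-different i≢j)

      chosen-midpoints-exhaust : (chosen : ∀ i → ∃ λ j → Inc (M j) (ray i)) → ∀ m → ∃ λ i → Inc (M m) (ray i)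
      chosen-midpoints-exhaust chosen m = i , ≡.subst (λ j → Inc (M j) (ray i)) (≡.sym m≡μᵢ) (proj₂ (chosen i))
        where
        μ : Fin (length targets) → Fin 5
        μ = proj₁ ∘ chosen
        m-chosen : m ∈ tabulate μ
        m-chosen = unique-enumerates (tabulate⁺ {R = _≢_} (chosen-distinct chosen))
                     (≡.trans (length-tabulate μ) five-targets) m
        i = proj₁ (∈-tabulate⁻ m-chosen)
        m≡μᵢ = proj₂ (∈-tabulate⁻ m-chosen)

      -- every choice of midpoints on the rays exists up to double negation, so M m is on a ray
      pencil-covers-midpoints : ∀ m → ¬ ¬ (∃ λ i → Collinear (M m) Y (target i))
      pencil-covers-midpoints m ¬on =
        ¬¬-Fin-choice (λ i → sparse⇒midpoint (ray i) (All.lookup sparse-joins (∈-lookup i) (ray i) (Y∈ray i) (target∈ray i)))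
        λ chosen → let (i , Mₘ∈rayᵢ) = chosen-midpoints-exhaust chosen m in
        ¬on (i , ray i , Mₘ∈rayᵢ , Y∈ray i , target∈ray i)

    record Placed : Set ℓ where
      field
        hole : Fin 6
        side-of : Side
        only : OnlyOn side-of (H hole)
    open Placed

    placed-distinct : (p q : Placed) → side-of p ≢ side-of q → hole p ≢ hole q
    placed-distinct p q sides-differ holes-equal =
      proj₂ (only q) (side-of p) sides-differ (≡.subst (λ i → Inc (H i) (side (side-of p))) holes-equal (proj₁ (only p)))

    survivor-off-side : (p : Placed) (l : Line) (Q X : Point) → Inc (H (hole p)) l → Inc Q l →
      ¬ Inc Q (side (side-of p)) → Inc X l → Inc X (side (side-of p)) → Survivor X → ⊥
    survivor-off-side p l Q X p∈l Q∈l Q∉sₚ X∈l X∈sₚ (_ , X-not-hole) =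
      meet-unique Q X (H (hole p)) l (side (side-of p)) Q∈l Q∉sₚ X∈l X∈sₚ p∈l (proj₁ (only p)) (X-not-hole (hole p))

    vertex-line-sparse : (p : Placed) (l : Line) → Inc (vertex (side-of p)) l → Inc (H (hole p)) l → Sparse l
    vertex-line-sparse p l V∈l p∈l X Y X≁Y X∈l Y∈l X-survives Y-survives =
      is-vertex X X∈l X-survives λ X∼V → is-vertex Y Y∈l Y-survives λ Y∼V →
      X≁Y (same-point-trans X V Y X∼V (same-point-sym Y V Y∼V))
      where
      t = side-of p
      V = vertex t
      on-side-is-vertex : ∀ Z s → Inc Z l → Inc Z (side s) → Survivor Z → Dec (s ≡ t) → ¬ ¬ SamePoint Z V
      on-side-is-vertex Z s Z∈l Z∈t Z-survives (yes ≡.refl) _ =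
        survivor-off-side p l V Z p∈l V∈l (vertex-off-side t) Z∈l Z∈t Z-survives
      on-side-is-vertex Z s Z∈l Z∈s Z-survives (no s≢t) =
        meet-unique (H (hole p)) Z V l (side s) p∈l (proj₂ (only p) s s≢t) Z∈l Z∈s V∈l (vertex-on-side (≢-sym s≢t))
      is-vertex : ∀ Z → Inc Z l → Survivor Z → ¬ ¬ SamePoint Z V
      is-vertex Z Z∈l Z-survives Z≁V = OnT⇒on-side {Z} (proj₁ Z-survives) λ (s , Z∈s) →
        on-side-is-vertex Z s Z∈l Z∈s Z-survives (s ≟ᶠ t) Z≁V

    placed-line-sparse : (p q : Placed) → side-of p ≢ side-of q → (l : Line) →
      Inc (H (hole p)) l → Inc (H (hole q)) l → Sparse l
    placed-line-sparse p q sides-differ l p∈l q∈l X Y X≁Y X∈l Y∈l X-survives Y-survives =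
      OnT⇒on-side {X} (proj₁ X-survives) λ (s , X∈s) → OnT⇒on-side {Y} (proj₁ Y-survives) λ (s' , Y∈s') →
      let s≡s' = third-side-unique sides-differ (not-side-of-p X s X∈l X∈s X-survives) (not-side-of-q X s X∈l X∈s X-survives)
                                           (not-side-of-p Y s' Y∈l Y∈s' Y-survives) (not-side-of-q Y s' Y∈l Y∈s' Y-survives)
      in meet-unique (H (hole p)) X Y l (side s) p∈l (proj₂ (only p) s (not-side-of-p X s X∈l X∈s X-survives))
           X∈l X∈s Y∈l (≡.subst (λ u → Inc Y (side u)) (≡.sym s≡s') Y∈s') X≁Y
      where
      not-side-of-p : ∀ Z s → Inc Z l → Inc Z (side s) → Survivor Z → s ≢ side-of p
      not-side-of-p Z s Z∈l Z∈s Z-survives ≡.refl =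
        survivor-off-side p l (H (hole q)) Z p∈l q∈l (proj₂ (only q) (side-of p) sides-differ) Z∈l Z∈s Z-survives
      not-side-of-q : ∀ Z s → Inc Z l → Inc Z (side s) → Survivor Z → s ≢ side-of q
      not-side-of-q Z s Z∈l Z∈s Z-survives ≡.refl =
        survivor-off-side q l (H (hole p)) Z q∈l p∈l (proj₂ (only p) (side-of q) (≢-sym sides-differ)) Z∈l Z∈s Z-survives

    vertex-noncollinear : (p q : Placed) → side-of p ≢ side-of q →
      ¬ Collinear (H (hole p)) (vertex (side-of p)) (H (hole q))
    vertex-noncollinear p q sides-differ (l , p∈l , V∈l , q∈l) =
      meet-unique (H (hole p)) (vertex (side-of p)) (H (hole q)) l (side (side-of q)) p∈l
        (proj₂ (only p) (side-of q) (≢-sym sides-differ)) V∈l (vertex-on-side sides-differ) q∈l (proj₁ (only q))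
        (only-on⇒not-vertex (H (hole q)) (side-of p) (only q))

    Across : Placed → Set ℓ
    Across p = Σ Placed λ q → side-of q ≢ side-of p

    module PlacedPencil (p : Placed) (qs : List (Across p)) (four : length qs ≡ 4)
      (holes-differ : AllPairs (λ q q' → hole (proj₁ q) ≢ hole (proj₁ q')) qs) where

      Y : Point
      Y = H (hole p)

      targets : List Point
      targets = vertex (side-of p) ∷ List.map (H ∘ hole ∘ proj₁) qs

      Y≁targets : All (λ P → ¬ SamePoint Y P) targets
      Y≁targets = (λ Y∼V → only-on⇒not-vertex Y (side-of p) (only p) (same-point-sym Y (vertex (side-of p)) Y∼V))
        ∷ Allₚ.map⁺ (All.universal (λ (q , q-across) →
            holes-distinct (hole p) (hole q) (placed-distinct p q (≢-sym q-across))) qs)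

      sparse-joins : All (λ P → ∀ l → Inc Y l → Inc P l → Sparse l) targets
      sparse-joins = (λ l Y∈l V∈l → vertex-line-sparse p l V∈l Y∈l)
        ∷ Allₚ.map⁺ (All.universal (λ (q , q-across) l Y∈l q∈l →
            placed-line-sparse p q (≢-sym q-across) l Y∈l q∈l) qs)

      noncollinear : AllPairs (λ P Q → ¬ Collinear Y P Q) targets
      noncollinear = Allₚ.map⁺ (All.universal (λ (q , q-across) → vertex-noncollinear p q (≢-sym q-across)) qs)
        ∷ AllPairsₚ.map⁺ (AllPairs.map (λ {(q , q-across)} {(q' , q'-across)} q≢q' →
            no-three-holes-collinear (hole p) (hole q) (hole q')
              (placed-distinct p q (≢-sym q-across)) q≢q' (placed-distinct p q' (≢-sym q'-across))) holes-differ)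

      open Pencil Y targets (≡.cong ℕ.suc (≡.trans (length-map _ qs) four))
        (λ j → midpoint-not-on-side j (side-of p) Y (proj₁ (only p))) Y≁targets sparse-joins noncollinear public

    module AtMidpoint (m : Fin 5) where

      record Spoke (s : Side) (l : Line) : Set ℓ where
        field
          spoke-hole : Fin 6
          hole-on-side : Inc (H spoke-hole) (side s)
          vertex∈ : Inc (vertex s) l
          hole∈ : Inc (H spoke-hole) l
          midpoint∈ : Inc (M m) l
      open Spoke

      𝓛-line⇒spoke : ∀ l → InL H l → Inc (M m) l → ¬ ¬ (∃ λ s → Spoke s l)
      𝓛-line⇒spoke l (i , inj₁ (Hᵢ∈BC , A∈l , Hᵢ∈l)) Mₘ∈l ¬spoke =
        collinear⇒on-join {B} {C} {H i} B≁C Hᵢ∈BC λ Hᵢ∈ℓA → ¬spoke (sideA , record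
          { spoke-hole = i ; hole-on-side = Hᵢ∈ℓA ; vertex∈ = A∈l ; hole∈ = Hᵢ∈l ; midpoint∈ = Mₘ∈l })
      𝓛-line⇒spoke l (i , inj₂ (inj₁ (Hᵢ∈CA , B∈l , Hᵢ∈l))) Mₘ∈l ¬spoke =
        collinear⇒on-join {C} {A} {H i} C≁A Hᵢ∈CA λ Hᵢ∈ℓB → ¬spoke (sideB , record
          { spoke-hole = i ; hole-on-side = Hᵢ∈ℓB ; vertex∈ = B∈l ; hole∈ = Hᵢ∈l ; midpoint∈ = Mₘ∈l })
      𝓛-line⇒spoke l (i , inj₂ (inj₂ (Hᵢ∈AB , C∈l , Hᵢ∈l))) Mₘ∈l ¬spoke =
        collinear⇒on-join {A} {B} {H i} A≁B Hᵢ∈AB λ Hᵢ∈ℓC → ¬spoke (sideC , record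
          { spoke-hole = i ; hole-on-side = Hᵢ∈ℓC ; vertex∈ = C∈l ; hole∈ = Hᵢ∈l ; midpoint∈ = Mₘ∈l })

      -- two spokes at the same side s are the line through vertex s and M m
      spoke-sides-differ : ∀ {s s' l l'} → Spoke s l → Spoke s' l' → ¬ SameLine l l' → s ≢ s'
      spoke-sides-differ {s} {_} {l} {l'} σ σ' l≁l' ≡.refl =
        line-unique (vertex s) (M m) l l' (λ V∼M → midpoint-not-vertex m s (same-point-sym (vertex s) (M m) V∼M))
          (vertex∈ σ) (midpoint∈ σ) (vertex∈ σ') (midpoint∈ σ') l≁l'

      spokes-everywhere : (l₁ l₂ l₃ : Line) → ¬ SameLine l₁ l₂ → ¬ SameLine l₂ l₃ → ¬ SameLine l₁ l₃ →
        InL H l₁ → InL H l₂ → InL H l₃ → Inc (M m) l₁ → Inc (M m) l₂ → Inc (M m) l₃ →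
        ¬ ¬ (∀ s → ∃ λ l → Spoke s l)
      spokes-everywhere l₁ l₂ l₃ l₁≁l₂ l₂≁l₃ l₁≁l₃ l₁∈𝓛 l₂∈𝓛 l₃∈𝓛 Mₘ∈l₁ Mₘ∈l₂ Mₘ∈l₃ ¬spokes =
        𝓛-line⇒spoke l₁ l₁∈𝓛 Mₘ∈l₁ λ (s₁ , σ₁) → 𝓛-line⇒spoke l₂ l₂∈𝓛 Mₘ∈l₂ λ (s₂ , σ₂) →
        𝓛-line⇒spoke l₃ l₃∈𝓛 Mₘ∈l₃ λ (s₃ , σ₃) → ¬spokes λ s →
        case all-sides (spoke-sides-differ σ₁ σ₂ l₁≁l₂) (spoke-sides-differ σ₁ σ₃ l₁≁l₃)
                       (spoke-sides-differ σ₂ σ₃ l₂≁l₃) s of λ where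
          (here ≡.refl) → l₁ , σ₁
          (there (here ≡.refl)) → l₂ , σ₂
          (there (there (here ≡.refl))) → l₃ , σ₃

      -- the hole of a spoke lies on its side only: the spoke line meets any other side at the vertex
      spoke-hole-only : ∀ {s l} (σ : Spoke s l) → OnlyOn s (H (spoke-hole σ))
      spoke-hole-only {s} {l} σ = hole-on-side σ , λ t t≢s Hₓ∈t →
        meet-unique (M m) (vertex s) (H (spoke-hole σ)) l (side t) (midpoint∈ σ) (midpoint-off-side m t)
          (vertex∈ σ) (vertex-on-side (≢-sym t≢s)) (hole∈ σ) Hₓ∈t λ V∼Hₓ →
        vertex-off-side s (inc-resp-point (H (spoke-hole σ)) (vertex s) (side s)
          (same-point-sym (vertex s) (H (spoke-hole σ)) V∼Hₓ) (hole-on-side σ))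

      -- M m is not collinear with two pairs of holes sharing the hole of p: both lines would be
      -- the line through M m and that hole, making three holes collinear
      m-collinear-once : (p : Placed) {y z : Fin 6} → hole p ≢ y → y ≢ z → hole p ≢ z →
        Collinear (M m) (H (hole p)) (H y) → ¬ Collinear (M m) (H (hole p)) (H z)
      m-collinear-once p {y} {z} p≢y y≢z p≢z (l , Mₘ∈l , p∈l , y∈l) (l' , Mₘ∈l' , p∈l' , z∈l') =
        inc-transfer (M m) (H (hole p)) (H z) l l' (midpoint-not-on-side m (side-of p) (H (hole p)) (proj₁ (only p)))
          Mₘ∈l p∈l Mₘ∈l' p∈l' z∈l' λ z∈l → no-three-holes-collinear (hole p) y z p≢y y≢z p≢z (l , p∈l , y∈l , z∈l)

      m-collinear-sym : ∀ y z → Collinear (M m) (H y) (H z) → Collinear (M m) (H z) (H y)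
      m-collinear-sym _ _ (l , Mₘ∈l , y∈l , z∈l) = l , Mₘ∈l , z∈l , y∈l

      module WithSpokes (spoke : ∀ s → ∃ λ l → Spoke s l) where

        spoke-line : Side → Line
        spoke-line s = proj₁ (spoke s)

        X : Side → Fin 6
        X s = spoke-hole (proj₂ (spoke s))

        placed-spoke : Side → Placed
        placed-spoke s = record { hole = X s ; side-of = s ; only = spoke-hole-only (proj₂ (spoke s)) }

        NonSpoke : Fin 6 → Set
        NonSpoke y = ∀ s → y ≢ X s

        -- M m is not collinear with a non-spoke hole on side t and vertex t: their line would be
        -- the spoke line at t, which meets side t only at X t
        m-off-vertex-line : (p : Placed) → NonSpoke (hole p) → ¬ Collinear (M m) (H (hole p)) (vertex (side-of p))
        m-off-vertex-line p y-non-spoke (l , Mₘ∈l , y∈l , V∈l) =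
          inc-transfer (M m) (vertex t) (H y) (spoke-line t) l (midpoint-not-vertex m t)
            (midpoint∈ σ) (vertex∈ σ) Mₘ∈l V∈l y∈l λ y∈σ →
          meet-unique (M m) (H y) (H (X t)) (spoke-line t) (side t) (midpoint∈ σ) (midpoint-off-side m t)
            y∈σ (proj₁ (only p)) (hole∈ σ) (hole-on-side σ) (holes-distinct y (X t) (y-non-spoke t))
          where
          t = side-of p
          y = hole p
          σ = proj₂ (spoke t)

        -- M m is not collinear with a hole placed on side t and the spoke hole of another side s:
        -- their line would be the spoke line at s, which meets side t only at vertex s
        m-off-spoke-hole-line : (p : Placed) (s : Side) → s ≢ side-of p → ¬ Collinear (M m) (H (hole p)) (H (X s))
        m-off-spoke-hole-line p s s≢t (l , Mₘ∈l , y∈l , Xₛ∈l) =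
          inc-transfer (M m) (H (X s)) (H y) (spoke-line s) l (midpoint-not-on-side m s (H (X s)) (hole-on-side σ))
            (midpoint∈ σ) (hole∈ σ) Mₘ∈l Xₛ∈l y∈l λ y∈σ →
          meet-unique (M m) (vertex s) (H y) (spoke-line s) (side t) (midpoint∈ σ) (midpoint-off-side m t)
            (vertex∈ σ) (vertex-on-side s≢t) y∈σ (proj₁ (only p)) (only-on⇒not-vertex (H y) s (only p))
          where
          t = side-of p
          y = hole p
          σ = proj₂ (spoke s)

        -- Let non-spoke holes be placed on the three sides t, t', t''. The pencil at the one on t
        -- (lines to vertex t, X t', X t'' and the other two) covers M m, which lies on none of the
        -- first three lines; so M m is collinear with two of the non-spoke holes.
        m-joins-non-spoke : (p p' p'' : Placed) → NonSpoke (hole p) → NonSpoke (hole p') → NonSpoke (hole p'') →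
          side-of p' ≢ side-of p → side-of p'' ≢ side-of p → side-of p' ≢ side-of p'' →
          ¬ ¬ (Collinear (M m) (H (hole p)) (H (hole p')) ⊎ Collinear (M m) (H (hole p)) (H (hole p'')))
        m-joins-non-spoke p p' p'' p-non-spoke p'-non-spoke p''-non-spoke t'≢t t''≢t t'≢t'' ¬joins =
          pencil-covers-midpoints m (¬joins ∘ on-non-spoke-line)
          where
          t' = side-of p'
          t'' = side-of p''
          open PlacedPencil p ((placed-spoke t' , t'≢t) ∷ (placed-spoke t'' , t''≢t) ∷ (p' , t'≢t) ∷ (p'' , t''≢t) ∷ [])
            ≡.refl ((placed-distinct (placed-spoke t') (placed-spoke t'') t'≢t'' ∷ ≢-sym (p'-non-spoke t')
                      ∷ placed-distinct (placed-spoke t') p'' t'≢t'' ∷ [])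
                    ∷ (placed-distinct (placed-spoke t'') p' (≢-sym t'≢t'') ∷ ≢-sym (p''-non-spoke t'') ∷ [])
                    ∷ (placed-distinct p' p'' t'≢t'' ∷ []) ∷ [] ∷ [])
            using (pencil-covers-midpoints; target)
          on-non-spoke-line : (∃ λ i → Collinear (M m) (H (hole p)) (target i)) →
            Collinear (M m) (H (hole p)) (H (hole p')) ⊎ Collinear (M m) (H (hole p)) (H (hole p''))
          on-non-spoke-line (zero , M-p-V) = ⊥-elim (m-off-vertex-line p p-non-spoke M-p-V)
          on-non-spoke-line (suc zero , M-p-X) = ⊥-elim (m-off-spoke-hole-line p t' t'≢t M-p-X)
          on-non-spoke-line (suc (suc zero) , M-p-X) = ⊥-elim (m-off-spoke-hole-line p t'' t''≢t M-p-X)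
          on-non-spoke-line (suc (suc (suc zero)) , M-p-p') = inj₁ M-p-p'
          on-non-spoke-line (suc (suc (suc (suc zero))) , M-p-p'') = inj₂ M-p-p''

        -- two non-spoke holes lie on different sides: with the spoke hole they would be collinear
        non-spoke-sides-differ : ∀ {y y'} t t' → y ≢ y' → NonSpoke y → NonSpoke y' →
          Inc (H y) (side t) → Inc (H y') (side t') → t ≢ t'
        non-spoke-sides-differ {y} {y'} t _ y≢y' y-non-spoke y'-non-spoke y∈t y'∈t ≡.refl =
          no-three-holes-collinear y y' (X t) y≢y' (y'-non-spoke t) (y-non-spoke t)
            (side t , y∈t , y'∈t , hole-on-side (proj₂ (spoke t)))

        only-on-its-side : ∀ {y y' y''} t t' t'' → y ≢ y' → y ≢ y'' →
          NonSpoke y → NonSpoke y' → NonSpoke y'' →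
          Inc (H y) (side t) → Inc (H y') (side t') → Inc (H y'') (side t'') → t' ≢ t'' → OnlyOn t (H y)
        only-on-its-side t t' t'' y≢y' y≢y'' y-ns y'-ns y''-ns y∈t y'∈t' y''∈t'' t'≢t'' = y∈t , λ s s≢t y∈s →
          case all-sides (non-spoke-sides-differ t t' y≢y' y-ns y'-ns y∈t y'∈t')
                         (non-spoke-sides-differ t t'' y≢y'' y-ns y''-ns y∈t y''∈t'') t'≢t'' s of λ where
            (here s≡t) → s≢t s≡t
            (there (here ≡.refl)) → non-spoke-sides-differ s t' y≢y' y-ns y'-ns y∈s y'∈t' ≡.refl
            (there (there (here ≡.refl))) → non-spoke-sides-differ s t'' y≢y'' y-ns y''-ns y∈s y''∈t'' ≡.refl

        non-spoke-holes : ∃ λ y₁ → ∃ λ y₂ → ∃ λ y₃ →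
          (NonSpoke y₁ × NonSpoke y₂ × NonSpoke y₃) × (y₁ ≢ y₂ × y₁ ≢ y₃ × y₂ ≢ y₃)
        non-spoke-holes
          with y₁ , y₁∉ ← fresh (X sideA ∷ X sideB ∷ X sideC ∷ []) (ℕ.<ᵇ⇒< 3 6 _)
          with y₂ , y₂∉ ← fresh (y₁ ∷ X sideA ∷ X sideB ∷ X sideC ∷ []) (ℕ.<ᵇ⇒< 4 6 _)
          with y₃ , y₃∉ ← fresh (y₂ ∷ y₁ ∷ X sideA ∷ X sideB ∷ X sideC ∷ []) (ℕ.<ᵇ⇒< 5 6 _)
          = y₁ , y₂ , y₃ , (non-spoke y₁∉ , non-spoke (y₂∉ ∘ there) , non-spoke (y₃∉ ∘ there ∘ there))
          , (≢-sym (y₂∉ ∘ here) , ≢-sym (y₃∉ ∘ there ∘ here) , ≢-sym (y₃∉ ∘ here))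
          where
          non-spoke : ∀ {y} → y ∉ X sideA ∷ X sideB ∷ X sideC ∷ [] → NonSpoke y
          non-spoke y∉ sideA = y∉ ∘ here
          non-spoke y∉ sideB = y∉ ∘ there ∘ here
          non-spoke y∉ sideC = y∉ ∘ there ∘ there ∘ here

        -- Three non-spoke holes placed on the three sides: by m-joins-non-spoke at two of them,
        -- M m lies on two lines joining pairs of them that share a hole, which is impossible.
        non-spoke-triangle : (p₁ p₂ p₃ : Placed) →
          NonSpoke (hole p₁) → NonSpoke (hole p₂) → NonSpoke (hole p₃) →
          side-of p₁ ≢ side-of p₂ → side-of p₁ ≢ side-of p₃ → side-of p₂ ≢ side-of p₃ → ⊥
        non-spoke-triangle p₁ p₂ p₃ ns₁ ns₂ ns₃ t₁≢t₂ t₁≢t₃ t₂≢t₃ =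
          m-joins-non-spoke p₁ p₂ p₃ ns₁ ns₂ ns₃ (≢-sym t₁≢t₂) (≢-sym t₁≢t₃) t₂≢t₃ λ where
            (inj₁ M-y₁-y₂) → m-joins-non-spoke p₃ p₁ p₂ ns₃ ns₁ ns₂ t₁≢t₃ t₂≢t₃ t₁≢t₂ λ where
              (inj₁ M-y₃-y₁) → m-collinear-once p₁ y₁≢y₂ y₂≢y₃ y₁≢y₃ M-y₁-y₂ (m-collinear-sym y₃ y₁ M-y₃-y₁)
              (inj₂ M-y₃-y₂) → m-collinear-once p₂ (≢-sym y₁≢y₂) y₁≢y₃ y₂≢y₃
                                 (m-collinear-sym y₁ y₂ M-y₁-y₂) (m-collinear-sym y₃ y₂ M-y₃-y₂)
            (inj₂ M-y₁-y₃) → m-joins-non-spoke p₂ p₁ p₃ ns₂ ns₁ ns₃ t₁≢t₂ (≢-sym t₂≢t₃) t₁≢t₃ λ where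
              (inj₁ M-y₂-y₁) → m-collinear-once p₁ y₁≢y₃ (≢-sym y₂≢y₃) y₁≢y₂ M-y₁-y₃ (m-collinear-sym y₂ y₁ M-y₂-y₁)
              (inj₂ M-y₂-y₃) → m-collinear-once p₃ (≢-sym y₁≢y₃) y₁≢y₂ (≢-sym y₂≢y₃)
                                 (m-collinear-sym y₁ y₃ M-y₁-y₃) (m-collinear-sym y₂ y₃ M-y₂-y₃)
          where
          y₁ = hole p₁
          y₂ = hole p₂
          y₃ = hole p₃
          y₁≢y₂ = placed-distinct p₁ p₂ t₁≢t₂
          y₁≢y₃ = placed-distinct p₁ p₃ t₁≢t₃
          y₂≢y₃ = placed-distinct p₂ p₃ t₂≢t₃

        non-spoke-holes-on-sides : ∀ y₁ y₂ y₃ t₁ t₂ t₃ → NonSpoke y₁ → NonSpoke y₂ → NonSpoke y₃ →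
          y₁ ≢ y₂ → y₁ ≢ y₃ → y₂ ≢ y₃ → Inc (H y₁) (side t₁) → Inc (H y₂) (side t₂) → Inc (H y₃) (side t₃) → ⊥
        non-spoke-holes-on-sides y₁ y₂ y₃ t₁ t₂ t₃ ns₁ ns₂ ns₃ y₁≢y₂ y₁≢y₃ y₂≢y₃ y₁∈t₁ y₂∈t₂ y₃∈t₃ =
          non-spoke-triangle p₁ p₂ p₃ ns₁ ns₂ ns₃ t₁≢t₂ t₁≢t₃ t₂≢t₃
          where
          t₁≢t₂ = non-spoke-sides-differ t₁ t₂ y₁≢y₂ ns₁ ns₂ y₁∈t₁ y₂∈t₂
          t₁≢t₃ = non-spoke-sides-differ t₁ t₃ y₁≢y₃ ns₁ ns₃ y₁∈t₁ y₃∈t₃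
          t₂≢t₃ = non-spoke-sides-differ t₂ t₃ y₂≢y₃ ns₂ ns₃ y₂∈t₂ y₃∈t₃
          p₁ p₂ p₃ : Placed
          p₁ = record { hole = y₁ ; side-of = t₁
                      ; only = only-on-its-side t₁ t₂ t₃ y₁≢y₂ y₁≢y₃ ns₁ ns₂ ns₃ y₁∈t₁ y₂∈t₂ y₃∈t₃ t₂≢t₃ }
          p₂ = record { hole = y₂ ; side-of = t₂
                      ; only = only-on-its-side t₂ t₁ t₃ (≢-sym y₁≢y₂) y₂≢y₃ ns₂ ns₁ ns₃ y₂∈t₂ y₁∈t₁ y₃∈t₃ t₁≢t₃ }
          p₃ = record { hole = y₃ ; side-of = t₃
                      ; only = only-on-its-side t₃ t₁ t₂ (≢-sym y₁≢y₃) (≢-sym y₂≢y₃) ns₃ ns₁ ns₂ y₃∈t₃ y₁∈t₁ y₂∈t₂ t₁≢t₂ }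

        spokes-impossible : ⊥
        spokes-impossible =
          case non-spoke-holes of λ (y₁ , y₂ , y₃ , (ns₁ , ns₂ , ns₃) , (y₁≢y₂ , y₁≢y₃ , y₂≢y₃)) →
          OnT⇒on-side {H y₁} (holes-on-T y₁) λ (t₁ , y₁∈t₁) →
          OnT⇒on-side {H y₂} (holes-on-T y₂) λ (t₂ , y₂∈t₂) →
          OnT⇒on-side {H y₃} (holes-on-T y₃) λ (t₃ , y₃∈t₃) →
          non-spoke-holes-on-sides y₁ y₂ y₃ t₁ t₂ t₃ ns₁ ns₂ ns₃ y₁≢y₂ y₁≢y₃ y₂≢y₃ y₁∈t₁ y₂∈t₂ y₃∈t₃

-- Lemma 11. Three lines of 𝓛 through M m would be spokes at all three sides, which is
-- impossible.
lemma11 : ∀ {c ℓ : Level} (F : FiniteField c ℓ) →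
    let open PG2 F in
    (A B C : Point) → ¬ Collinear A B C →
    let open Triangle A B C in
    (H : Fin 6 → Point) → (M : Fin 5 → Point) →
    (∀ i j → i ≢ j → ¬ SamePoint (H i) (H j)) →
    (∀ i → OnT (H i)) →
    (∀ i j → i ≢ j → ¬ SamePoint (M i) (M j)) →
    (∀ j → ¬ OnT (M j)) →
    DoubleBlocking (InD H M) →
    (∀ i j k → i ≢ j → j ≢ k → i ≢ k → ¬ Collinear (H i) (H j) (H k)) →
    ∀ (m : Fin 5) → ¬ (Σ Line λ l₁ → Σ Line λ l₂ → Σ Line λ l₃ →
    ¬ SameLine l₁ l₂ × ¬ SameLine l₂ l₃ × ¬ SameLine l₁ l₃ ×
    InL H l₁ × InL H l₂ × InL H l₃ ×
    Inc (M m) l₁ × Inc (M m) l₂ × Inc (M m) l₃)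
lemma11 F A B C ABC-noncollinear H M holes-distinct holes-on-T _ midpoints-off-T double-blocking
        no-three-holes-collinear m
        (l₁ , l₂ , l₃ , l₁≁l₂ , l₂≁l₃ , l₁≁l₃ , l₁∈𝓛 , l₂∈𝓛 , l₃∈𝓛 , Mₘ∈l₁ , Mₘ∈l₂ , Mₘ∈l₃) =
  spokes-everywhere l₁ l₂ l₃ l₁≁l₂ l₂≁l₃ l₁≁l₃ l₁∈𝓛 l₂∈𝓛 l₃∈𝓛 Mₘ∈l₁ Mₘ∈l₂ Mₘ∈l₃ λ spoke →
  WithSpokes.spokes-impossible spoke
  where
  open TriangleGeometry F A B C ABC-noncollinear
  open Configuration H M holes-distinct holes-on-T midpoints-off-T double-blocking
                     no-three-holes-collinear
  open AtMidpoint m
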